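{- Let $n\geq k\geq 1$, let $S\neq T$ be $k$-subsets of $[n]$ and let $(x,y)\in([n]\setminus[k])\times[k]$. Then $a(S,(x,y))=1$ and $a(T,(x,y))=0$ if and only if all three of the following hold: (i) $(x,y)\in f(S)\setminus f(T)$; (ii) there is no $z$ with $x<z$ and $(z,y)\in f(T)$; (iii) there is no $z$ with $z<y$ and $(x,z)\in f(T)$.
   Context: $[m]=\{1,\dots,m\}$. For a $k$-subset $S$ of $[n]$ define $f(S)\subseteq([n]\setminus[k])\times[k]$ as follows: if $S=[k]$ then $f(S)=\emptyset$; otherwise let $S\setminus[k]=\{x_1,\dots,x_t\}$ with $n\geq x_1>\dots>x_t\geq k+1$ and $[k]\setminus S=\{y_1,\dots,y_t\}$ with $1\leq y_1<\dots<y_t\leq k$, and set $f(S)=\{(x_1,y_1),\dots,(x_t,y_t)\}$. For each $k$-subset $S$ and each pair $(x,y)\in([n]\setminus[k])\times[k]$ define $a(S,(x,y))\in\{0,1,*\}$ by the first applicable rule: (1) if $(x,y)\in f(S)$, then $1$; (2) else if $\max(S)<x$, then $0$; (3) else if there is $z<y$ with $(x,z)\in f(S)$, then $*$; (4) else if $y\in S$, then $0$; (5) else if there is $z<x$ with $(z,y)\in f(S)$, then $0$; (6) else $*$. -}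

module Defs where

open import Data.Nat using (ℕ; zero; suc; _⊔_; _<ᵇ_; _≡ᵇ_)
open import Data.Bool using (Bool; true; false; if_then_else_; not; _∧_)
open import Data.List using (List; []; _∷_; reverse; zip; map; upTo; filterᵇ; foldr)
open import Data.Bool.ListAction using (any)
open import Data.Vec using (Vec; []; _∷_)
open import Data.Fin.Subset using (Subset)
open import Data.Product using (_×_; _,_; proj₁; proj₂)
open import Data.Product.Properties using (≡-dec)
open import Data.Nat.Properties using (_≟_)
open import Relation.Nullary using (does)
open import Data.List.Membership.DecPropositional (≡-dec _≟_ _≟_) using (_∈?_)

-- Convention: a subset S of [n] = {1,…,n} is a 'Subset n' (Vec Bool n);
-- position i : Fin n (0-based) corresponds to the element toℕ i + 1.

elemsFrom : ∀ {m} → ℕ → Vec Bool m → List ℕ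
elemsFrom i [] = []
elemsFrom i (true ∷ bs) = i ∷ elemsFrom (suc i) bs
elemsFrom i (false ∷ bs) = elemsFrom (suc i) bs

elems : ∀ {n} → Subset n → List ℕ
elems S = elemsFrom 1 S

inS : ∀ {n} → ℕ → Subset n → Bool
inS x S = any (λ s → s ≡ᵇ x) (elems S)

range : ℕ → List ℕ
range m = map suc (upTo m)

highDesc : ∀ {n} → ℕ → Subset n → List ℕ
highDesc k S = reverse (filterᵇ (λ s → k <ᵇ s) (elems S))

lowMissing : ∀ {n} → ℕ → Subset n → List ℕ
lowMissing k S = filterᵇ (λ y → not (inS y S)) (range k)

f : ∀ {n} → ℕ → Subset n → List (ℕ × ℕ)
f k S = zip (highDesc k S) (lowMissing k S)

maxS : ∀ {n} → Subset n → ℕ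
maxS S = foldr _⊔_ 0 (elems S)

data Val : Set where
  v0 v1 v* : Val

-- a(S,(x,y)) by the first applicable rule (1)–(6)
a : ∀ {n} → ℕ → Subset n → ℕ × ℕ → Val
a k S (x , y) =
  if does ((x , y) ∈? F) then v1
  else if maxS S <ᵇ x then v0
  else if any (λ p → (proj₁ p ≡ᵇ x) ∧ (proj₂ p <ᵇ y)) F then v*
  else if inS y S then v0
  else if any (λ p → (proj₂ p ≡ᵇ y) ∧ (proj₁ p <ᵇ x)) F then v0
  else v*
  where
  F = f k S

-- Rule (1) makes a(S,(x,y)) = 1 equivalent to (x,y) ∈ f(S), so everything hinges on when
-- a(T,(x,y)) = 0 for (x,y) ∉ f(T).  If rule (2) fires, every first coordinate of f(T) lies in T,
-- hence below x, and (ii), (iii) hold trivially.  Otherwise (iii) is exactly the failure of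
-- rule (3), and (ii) is equivalent to rule (4) or (5) firing: an element of T is never a second
-- coordinate of f(T), while y ∈ [k] ∖ T has exactly one partner z in f(T), and z ≠ x.  That y has
-- a partner at all is a counting fact: when |T| = k, the lists [k] ∖ T and T ∖ [k] zipped by f
-- both have length k − |T ∩ [k]|.

module Submission where

open import Defs
open import Data.Nat using (ℕ; _≤_; _<_)
open import Data.Product using (_×_; _,_; ∃)
open import Data.Fin.Subset using (Subset; ∣_∣)
open import Data.List.Membership.Propositional using (_∈_; _∉_)
open import Relation.Binary.PropositionalEquality using (_≡_; _≢_)
open import Relation.Nullary using (¬_)
open import Function.Bundles using (_⇔_)

open import Data.Bool using (Bool; true; false; not; _∧_; _∨_; T; if_then_else_)
open import Data.Bool.ListAction using (any)
open import Data.Bool.Properties using (T-∧; T-not-≡)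
open import Data.Empty using (⊥-elim)
open import Data.List using (List; []; _∷_; zip; length; filterᵇ; foldr; applyUpTo)
open import Data.List.Properties using (length-reverse; map-upTo)
open import Data.List.Membership.Propositional using (find; lose)
open import Data.List.Membership.Propositional.Properties using (∈-filter⁺; ∈-filter⁻; ∈-map⁺; ∈-upTo⁺)
open import Data.List.Relation.Unary.All as All using ()
open import Data.List.Relation.Unary.AllPairs using (_∷_)
open import Data.List.Relation.Unary.Any using (here; there)
open import Data.List.Relation.Unary.Any.Properties using (any⁺; any⁻; reverse⁻)
open import Data.List.Relation.Unary.Unique.Propositional using (Unique)
import Data.List.Relation.Unary.Unique.Propositional.Properties as Unique
open import Data.Nat using (zero; suc; _+_; _⊔_; _<ᵇ_; _≡ᵇ_; s≤s)
open import Data.Nat.Properties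
  using ( _≟_; ≤-trans; ≤-reflexive; ≤-<-trans; <-irrefl; <-asym; <-cmp; m≤m⊔n; m≤n⊔m
        ; +-suc; +-identityʳ; +-cancelʳ-≡; suc-injective; <ᵇ⇒<; <⇒<ᵇ; ≡ᵇ⇒≡; ≡⇒≡ᵇ; <ᵇ-reflects-<)
open import Data.Product as Product using (proj₁; proj₂)
open import Data.Product.Properties using (≡-dec)
open import Data.Sum using (_⊎_; inj₁; inj₂; [_,_])
open import Data.Vec using (Vec; []; _∷_)
open import Function.Base using (_∘_; case_of_)
open import Function.Bundles using (Equivalence; mk⇔)
open import Relation.Binary using (tri<; tri≈; tri>)
open import Relation.Binary.PropositionalEquality using (refl; sym; trans; cong; subst)
open import Relation.Nullary using (Reflects; ofʸ; ofⁿ; fromEquivalence; yes; no; T?)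
open import Data.List.Membership.DecPropositional (≡-dec _≟_ _≟_) using (_∈?_)

module _ {A B : Set} where

  ∈-zip⁻ : ∀ {xs : List A} {ys : List B} {a b} → (a , b) ∈ zip xs ys → a ∈ xs × b ∈ ys
  ∈-zip⁻ {_ ∷ _}  {_ ∷ _}  (here refl) = here refl , here refl
  ∈-zip⁻ {_ ∷ xs} {_ ∷ ys} (there p)   = Product.map there there (∈-zip⁻ p)

  ∈-zip⁺ʳ : ∀ (xs : List A) {ys : List B} {b} → b ∈ ys → length ys ≤ length xs →
            ∃ λ a → (a , b) ∈ zip xs ys
  ∈-zip⁺ʳ (x ∷ _)  (here refl)  _            = x , here refl
  ∈-zip⁺ʳ (_ ∷ xs) (there b∈ys) (s≤s ys≤xs) = Product.map₂ there (∈-zip⁺ʳ xs b∈ys ys≤xs)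

  ∈-zip-unique-fst : ∀ {xs : List A} {ys : List B} → Unique ys →
                     ∀ {a a′ b} → (a , b) ∈ zip xs ys → (a′ , b) ∈ zip xs ys → a ≡ a′
  ∈-zip-unique-fst {_ ∷ _} {_ ∷ _} _           (here refl) (here refl) = refl
  ∈-zip-unique-fst {_ ∷ _} {_ ∷ _} (y∉ys ∷ _) (here refl) (there p)   =
    ⊥-elim (All.lookup y∉ys (proj₂ (∈-zip⁻ p)) refl)
  ∈-zip-unique-fst {_ ∷ _} {_ ∷ _} (y∉ys ∷ _) (there p)   (here refl) =
    ⊥-elim (All.lookup y∉ys (proj₂ (∈-zip⁻ p)) refl)
  ∈-zip-unique-fst {_ ∷ _} {_ ∷ _} (_ ∷ u)    (there p)   (there q)   = ∈-zip-unique-fst u p q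

∈⇒≤foldr-⊔ : ∀ {x xs} → x ∈ xs → x ≤ foldr _⊔_ 0 xs
∈⇒≤foldr-⊔ {xs = y ∷ _} (here refl) = m≤m⊔n y _
∈⇒≤foldr-⊔ {xs = y ∷ _} (there p)   = ≤-trans (∈⇒≤foldr-⊔ p) (m≤n⊔m y _)

bitAt : ∀ {m} → Vec Bool m → ℕ → Bool
bitAt []       _       = false
bitAt (b ∷ _)  zero    = b
bitAt (_ ∷ bs) (suc j) = bitAt bs j

countUpTo : ∀ {m} → ℕ → Vec Bool m → ℕ
countUpTo _       []           = 0
countUpTo zero    (_ ∷ _)      = 0
countUpTo (suc r) (true ∷ bs)  = suc (countUpTo r bs)
countUpTo (suc r) (false ∷ bs) = countUpTo r bs

any≡ᵇzero-elemsFrom-suc : ∀ {m} i (bs : Vec Bool m) → any (_≡ᵇ 0) (elemsFrom (suc i) bs) ≡ false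
any≡ᵇzero-elemsFrom-suc i []           = refl
any≡ᵇzero-elemsFrom-suc i (true ∷ bs)  = any≡ᵇzero-elemsFrom-suc (suc i) bs
any≡ᵇzero-elemsFrom-suc i (false ∷ bs) = any≡ᵇzero-elemsFrom-suc (suc i) bs

any≡ᵇsuc-elemsFrom-suc : ∀ {m} i y (bs : Vec Bool m) →
                         any (_≡ᵇ suc y) (elemsFrom (suc i) bs) ≡ any (_≡ᵇ y) (elemsFrom i bs)
any≡ᵇsuc-elemsFrom-suc i y []           = refl
any≡ᵇsuc-elemsFrom-suc i y (true ∷ bs)  = cong ((i ≡ᵇ y) ∨_) (any≡ᵇsuc-elemsFrom-suc (suc i) y bs)
any≡ᵇsuc-elemsFrom-suc i y (false ∷ bs) = any≡ᵇsuc-elemsFrom-suc (suc i) y bs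

any≡ᵇ-elemsFrom-zero : ∀ {m} j (bs : Vec Bool m) → any (_≡ᵇ j) (elemsFrom 0 bs) ≡ bitAt bs j
any≡ᵇ-elemsFrom-zero j       []           = refl
any≡ᵇ-elemsFrom-zero zero    (true ∷ bs)  = refl
any≡ᵇ-elemsFrom-zero zero    (false ∷ bs) = any≡ᵇzero-elemsFrom-suc 0 bs
any≡ᵇ-elemsFrom-zero (suc j) (true ∷ bs)  =
  trans (any≡ᵇsuc-elemsFrom-suc 0 j bs) (any≡ᵇ-elemsFrom-zero j bs)
any≡ᵇ-elemsFrom-zero (suc j) (false ∷ bs) =
  trans (any≡ᵇsuc-elemsFrom-suc 0 j bs) (any≡ᵇ-elemsFrom-zero j bs)

inS-suc : ∀ {n} j (S : Subset n) → inS (suc j) S ≡ bitAt S j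
inS-suc j S = trans (any≡ᵇsuc-elemsFrom-suc 0 j S) (any≡ᵇ-elemsFrom-zero j S)

length-filter-not+countUpTo : ∀ {m} (P : ℕ → Bool) g r (bs : Vec Bool m) →
  (∀ j → P (g j) ≡ bitAt bs j) →
  length (filterᵇ (not ∘ P) (applyUpTo g r)) + countUpTo r bs ≡ r
length-filter-not+countUpTo P g zero    []           _ = refl
length-filter-not+countUpTo P g zero    (_ ∷ _)      _ = refl
length-filter-not+countUpTo P g (suc r) []           P∘g≡bit rewrite P∘g≡bit 0 =
  cong suc (length-filter-not+countUpTo P (g ∘ suc) r [] (P∘g≡bit ∘ suc))
length-filter-not+countUpTo P g (suc r) (true ∷ bs)  P∘g≡bit rewrite P∘g≡bit 0 =
  trans (+-suc _ _) (cong suc (length-filter-not+countUpTo P (g ∘ suc) r bs (P∘g≡bit ∘ suc)))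
length-filter-not+countUpTo P g (suc r) (false ∷ bs) P∘g≡bit rewrite P∘g≡bit 0 =
  cong suc (length-filter-not+countUpTo P (g ∘ suc) r bs (P∘g≡bit ∘ suc))

length-filter-zero<-elemsFrom-suc : ∀ {m} i (bs : Vec Bool m) →
  length (filterᵇ (0 <ᵇ_) (elemsFrom (suc i) bs)) ≡ ∣ bs ∣
length-filter-zero<-elemsFrom-suc i []           = refl
length-filter-zero<-elemsFrom-suc i (true ∷ bs)  = cong suc (length-filter-zero<-elemsFrom-suc (suc i) bs)
length-filter-zero<-elemsFrom-suc i (false ∷ bs) = length-filter-zero<-elemsFrom-suc (suc i) bs

length-filter-suc<-elemsFrom-suc : ∀ {m} k i (bs : Vec Bool m) →
  length (filterᵇ (suc k <ᵇ_) (elemsFrom (suc i) bs)) ≡ length (filterᵇ (k <ᵇ_) (elemsFrom i bs))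
length-filter-suc<-elemsFrom-suc k i []           = refl
length-filter-suc<-elemsFrom-suc k i (true ∷ bs) with k <ᵇ i
... | true  = cong suc (length-filter-suc<-elemsFrom-suc k (suc i) bs)
... | false = length-filter-suc<-elemsFrom-suc k (suc i) bs
length-filter-suc<-elemsFrom-suc k i (false ∷ bs) = length-filter-suc<-elemsFrom-suc k (suc i) bs

length-filter<+countUpTo : ∀ {m} k (bs : Vec Bool m) →
  length (filterᵇ (k <ᵇ_) (elemsFrom 1 bs)) + countUpTo k bs ≡ ∣ bs ∣
length-filter<+countUpTo k       []           = refl
length-filter<+countUpTo zero    (b ∷ bs)     =
  trans (+-identityʳ _) (length-filter-zero<-elemsFrom-suc 0 (b ∷ bs))
length-filter<+countUpTo (suc k) (true ∷ bs)  = trans (+-suc _ _) (cong suc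
  (trans (cong (_+ countUpTo k bs) (length-filter-suc<-elemsFrom-suc k 1 bs)) (length-filter<+countUpTo k bs)))
length-filter<+countUpTo (suc k) (false ∷ bs) =
  trans (cong (_+ countUpTo k bs) (length-filter-suc<-elemsFrom-suc k 1 bs)) (length-filter<+countUpTo k bs)

length-lowMissing+countUpTo : ∀ {n} k (S : Subset n) → length (lowMissing k S) + countUpTo k S ≡ k
length-lowMissing+countUpTo k S rewrite map-upTo suc k =
  length-filter-not+countUpTo (λ y → inS y S) suc k S (λ j → inS-suc j S)

length-highDesc+countUpTo : ∀ {n} k (S : Subset n) → length (highDesc k S) + countUpTo k S ≡ ∣ S ∣
length-highDesc+countUpTo k S =
  trans (cong (_+ countUpTo k S) (length-reverse (filterᵇ (k <ᵇ_) (elems S)))) (length-filter<+countUpTo k S)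

length-lowMissing≡length-highDesc : ∀ {n} k (S : Subset n) → ∣ S ∣ ≡ k →
  length (lowMissing k S) ≡ length (highDesc k S)
length-lowMissing≡length-highDesc k S ∣S∣≡k = +-cancelʳ-≡ (countUpTo k S) _ _
  (trans (length-lowMissing+countUpTo k S) (sym (trans (length-highDesc+countUpTo k S) ∣S∣≡k)))

lowMissing-unique : ∀ {n} k (S : Subset n) → Unique (lowMissing k S)
lowMissing-unique k S =
  Unique.filter⁺ (T? ∘ λ y → not (inS y S)) {xs = range k} (Unique.map⁺ suc-injective (Unique.upTo⁺ k))

∈f⇒fst≤maxS : ∀ {n} k (S : Subset n) {z w} → (z , w) ∈ f k S → z ≤ maxS S
∈f⇒fst≤maxS k S p =
  ∈⇒≤foldr-⊔ (proj₁ (∈-filter⁻ (T? ∘ (k <ᵇ_)) {xs = elems S} (reverse⁻ (proj₁ (∈-zip⁻ p)))))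

∈f⇒snd∉ : ∀ {n} k (S : Subset n) {z w} → (z , w) ∈ f k S → inS w S ≡ false
∈f⇒snd∉ k S p =
  Equivalence.to T-not-≡ (proj₂ (∈-filter⁻ (T? ∘ λ y → not (inS y S)) {xs = range k} (proj₂ (∈-zip⁻ p))))

∈f-fst-unique : ∀ {n} k (S : Subset n) {z z′ w} → (z , w) ∈ f k S → (z′ , w) ∈ f k S → z ≡ z′
∈f-fst-unique k S = ∈-zip-unique-fst (lowMissing-unique k S)

∈f-of-missing : ∀ {n} k (S : Subset n) → ∣ S ∣ ≡ k → ∀ {y} → 1 ≤ y → y ≤ k → inS y S ≡ false →
  ∃ λ z → (z , y) ∈ f k S
∈f-of-missing k S ∣S∣≡k {suc y} _ y<k y∉S =
  ∈-zip⁺ʳ (highDesc k S) y∈lowMissing (≤-reflexive (length-lowMissing≡length-highDesc k S ∣S∣≡k))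
  where
  y∈lowMissing : suc y ∈ lowMissing k S
  y∈lowMissing = ∈-filter⁺ (T? ∘ λ y → not (inS y S)) (∈-map⁺ suc (∈-upTo⁺ y<k)) (Equivalence.from T-not-≡ y∉S)

rule₃-test rule₅-test : ℕ → ℕ → List (ℕ × ℕ) → Bool
rule₃-test x y = any (λ p → (proj₁ p ≡ᵇ x) ∧ (proj₂ p <ᵇ y))
rule₅-test x y = any (λ p → (proj₂ p ≡ᵇ y) ∧ (proj₁ p <ᵇ x))

rule₃-reflects : ∀ x y (F : List (ℕ × ℕ)) →
  Reflects (∃ λ z → z < y × (x , z) ∈ F) (rule₃-test x y F)
rule₃-reflects x y F = fromEquivalence sound complete
  where
  sound : T (rule₃-test x y F) → ∃ λ z → z < y × (x , z) ∈ F
  sound t with (x′ , z) , p∈F , x′≡ᵇx∧z<ᵇy ← find (any⁻ _ F t)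
    with x′≡ᵇx , z<ᵇy ← Equivalence.to T-∧ x′≡ᵇx∧z<ᵇy =
      z , <ᵇ⇒< z y z<ᵇy , subst (λ w → (w , z) ∈ F) (≡ᵇ⇒≡ x′ x x′≡ᵇx) p∈F
  complete : (∃ λ z → z < y × (x , z) ∈ F) → T (rule₃-test x y F)
  complete (z , z<y , p∈F) = any⁺ _ (lose p∈F (Equivalence.from T-∧ (≡⇒≡ᵇ x x refl , <⇒<ᵇ z<y)))

rule₅-reflects : ∀ x y (F : List (ℕ × ℕ)) →
  Reflects (∃ λ z → z < x × (z , y) ∈ F) (rule₅-test x y F)
rule₅-reflects x y F = fromEquivalence sound complete
  where
  sound : T (rule₅-test x y F) → ∃ λ z → z < x × (z , y) ∈ F
  sound t with (z , y′) , p∈F , y′≡ᵇy∧z<ᵇx ← find (any⁻ _ F t)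
    with y′≡ᵇy , z<ᵇx ← Equivalence.to T-∧ y′≡ᵇy∧z<ᵇx =
      z , <ᵇ⇒< z x z<ᵇx , subst (λ w → (z , w) ∈ F) (≡ᵇ⇒≡ y′ y y′≡ᵇy) p∈F
  complete : (∃ λ z → z < x × (z , y) ∈ F) → T (rule₅-test x y F)
  complete (z , z<x , p∈F) = any⁺ _ (lose p∈F (Equivalence.from T-∧ (≡⇒≡ᵇ y y refl , <⇒<ᵇ z<x)))

rules₂₋₆≢v1 : ∀ b₂ b₃ b₄ b₅ →
  (if b₂ then v0 else if b₃ then v* else if b₄ then v0 else if b₅ then v0 else v*) ≢ v1
rules₂₋₆≢v1 true  _     _     _     ()
rules₂₋₆≢v1 false true  _     _     ()
rules₂₋₆≢v1 false false true  _     ()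
rules₂₋₆≢v1 false false false true  ()
rules₂₋₆≢v1 false false false false ()

a≡v1⇔∈f : ∀ {n} k (S : Subset n) x y → a k S (x , y) ≡ v1 ⇔ (x , y) ∈ f k S
a≡v1⇔∈f k S x y = mk⇔ to from
  where
  to : a k S (x , y) ≡ v1 → (x , y) ∈ f k S
  to a≡v1 with (x , y) ∈? f k S
  ... | yes p = p
  ... | no _  = ⊥-elim
    (rules₂₋₆≢v1 (maxS S <ᵇ x) (rule₃-test x y (f k S)) (inS y S) (rule₅-test x y (f k S)) a≡v1)
  from : (x , y) ∈ f k S → a k S (x , y) ≡ v1
  from p with (x , y) ∈? f k S
  ... | yes _ = refl
  ... | no ∉f = ⊥-elim (∉f p)

a≡v0⇔rule₂⊎rule₄⊎rule₅ : ∀ {n} k (S : Subset n) x y → (x , y) ∉ f k S →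
  a k S (x , y) ≡ v0 ⇔
  (maxS S < x ⊎ (¬ ∃ λ z → z < y × (x , z) ∈ f k S) × (inS y S ≡ true ⊎ ∃ λ z → z < x × (z , y) ∈ f k S))
a≡v0⇔rule₂⊎rule₄⊎rule₅ k S x y ∉f
  with (x , y) ∈? f k S
     | maxS S <ᵇ x           | <ᵇ-reflects-< (maxS S) x
     | rule₃-test x y (f k S) | rule₃-reflects x y (f k S)
     | inS y S
     | rule₅-test x y (f k S) | rule₅-reflects x y (f k S)
... | yes p | _     | _         | _     | _       | _     | _     | _       = ⊥-elim (∉f p)
... | no _  | true  | ofʸ max<x | _     | _       | _     | _     | _       =
  mk⇔ (λ _ → inj₁ max<x) (λ _ → refl)
... | no _  | false | ofⁿ max≮x | true  | ofʸ r₃  | _     | _     | _       =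
  mk⇔ (λ ()) [ ⊥-elim ∘ max≮x , (λ (¬r₃ , _) → ⊥-elim (¬r₃ r₃)) ]
... | no _  | false | _         | false | ofⁿ ¬r₃ | true  | _     | _       =
  mk⇔ (λ _ → inj₂ (¬r₃ , inj₁ refl)) (λ _ → refl)
... | no _  | false | _         | false | ofⁿ ¬r₃ | false | true  | ofʸ r₅  =
  mk⇔ (λ _ → inj₂ (¬r₃ , inj₂ r₅)) (λ _ → refl)
... | no _  | false | ofⁿ max≮x | false | _       | false | false | ofⁿ ¬r₅ =
  mk⇔ (λ ()) [ ⊥-elim ∘ max≮x , (λ { (_ , inj₁ ()) ; (_ , inj₂ r₅) → ⊥-elim (¬r₅ r₅) }) ]

a≡v0⇔¬partner-above×¬partner-before : ∀ {n} k (S : Subset n) x y →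
  ∣ S ∣ ≡ k → 1 ≤ y → y ≤ k → (x , y) ∉ f k S →
  a k S (x , y) ≡ v0 ⇔ ((¬ ∃ λ z → x < z × (z , y) ∈ f k S) × (¬ ∃ λ z → z < y × (x , z) ∈ f k S))
a≡v0⇔¬partner-above×¬partner-before k S x y ∣S∣≡k 1≤y y≤k ∉f =
  mk⇔ (to ∘ Equivalence.to rules) (Equivalence.from rules ∘ from)
  where
  PartnerAbove PartnerBefore PartnerBelow : Set
  PartnerAbove  = ∃ λ z → x < z × (z , y) ∈ f k S
  PartnerBefore = ∃ λ z → z < y × (x , z) ∈ f k S
  PartnerBelow  = ∃ λ z → z < x × (z , y) ∈ f k S

  rules : a k S (x , y) ≡ v0 ⇔ (maxS S < x ⊎ (¬ PartnerBefore) × (inS y S ≡ true ⊎ PartnerBelow))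
  rules = a≡v0⇔rule₂⊎rule₄⊎rule₅ k S x y ∉f

  to : maxS S < x ⊎ (¬ PartnerBefore) × (inS y S ≡ true ⊎ PartnerBelow) → ¬ PartnerAbove × ¬ PartnerBefore
  to (inj₁ max<x) =
    (λ (_ , x<z , p) → <-asym x<z (≤-<-trans (∈f⇒fst≤maxS k S p) max<x)) ,
    (λ (_ , _ , p) → <-irrefl refl (≤-<-trans (∈f⇒fst≤maxS k S p) max<x))
  to (inj₂ (¬before , inj₁ y∈S)) =
    (λ (_ , _ , p) → case trans (sym y∈S) (∈f⇒snd∉ k S p) of λ ()) , ¬before
  to (inj₂ (¬before , inj₂ (z′ , z′<x , p′))) =
    (λ (_ , x<z , p) → <-asym x<z (subst (_< x) (sym (∈f-fst-unique k S p p′)) z′<x)) , ¬before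

  from : ¬ PartnerAbove × ¬ PartnerBefore → maxS S < x ⊎ (¬ PartnerBefore) × (inS y S ≡ true ⊎ PartnerBelow)
  from (¬above , ¬before) = inj₂ (¬before , rule₄⊎rule₅)
    where
    rule₄⊎rule₅ : inS y S ≡ true ⊎ PartnerBelow
    rule₄⊎rule₅ with inS y S in y∈?S
    ... | true  = inj₁ refl
    ... | false with z , p ← ∈f-of-missing k S ∣S∣≡k 1≤y y≤k y∈?S with <-cmp z x
    ...   | tri< z<x _ _ = inj₂ (z , z<x , p)
    ...   | tri≈ _ refl _ = ⊥-elim (∉f p)
    ...   | tri> _ _ x<z = ⊥-elim (¬above (z , x<z , p))

mainTheorem2 : (n k : ℕ) → 1 ≤ k → k ≤ n →
    (S T : Subset n) → ∣ S ∣ ≡ k → ∣ T ∣ ≡ k → S ≢ T →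
    (x y : ℕ) → k < x → x ≤ n → 1 ≤ y → y ≤ k →
    ((a k S (x , y) ≡ v1) × (a k T (x , y) ≡ v0)) ⇔
    (((x , y) ∈ f k S × (x , y) ∉ f k T)
      × (¬ ∃ (λ z → x < z × (z , y) ∈ f k T))
      × (¬ ∃ (λ z → z < y × (x , z) ∈ f k T)))
mainTheorem2 n k _ _ S T _ ∣T∣≡k _ x y _ _ 1≤y y≤k = mk⇔
  (λ (aS≡v1 , aT≡v0) → let ∉fT = ∉f-of-a≡v0 aT≡v0 in
    (Equivalence.to (a≡v1⇔∈f k S x y) aS≡v1 , ∉fT) , Equivalence.to (aT≡v0⇔ ∉fT) aT≡v0)
  (λ ((∈fS , ∉fT) , ¬partners) →
    Equivalence.from (a≡v1⇔∈f k S x y) ∈fS , Equivalence.from (aT≡v0⇔ ∉fT) ¬partners)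
  where
  aT≡v0⇔ : (x , y) ∉ f k T → a k T (x , y) ≡ v0 ⇔
            ((¬ ∃ λ z → x < z × (z , y) ∈ f k T) × (¬ ∃ λ z → z < y × (x , z) ∈ f k T))
  aT≡v0⇔ = a≡v0⇔¬partner-above×¬partner-before k T x y ∣T∣≡k 1≤y y≤k

  ∉f-of-a≡v0 : a k T (x , y) ≡ v0 → (x , y) ∉ f k T
  ∉f-of-a≡v0 aT≡v0 p = case trans (sym (Equivalence.from (a≡v1⇔∈f k T x y) p)) aT≡v0 of λ ()
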